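{- Let $k\geq 1$ and $m\geq 4$ be integers, and let $G_{k,m}$ be the bracelet graph with $m$ parts $V_1,\ldots,V_m$, each of cardinality $k$. Then $G_{k,m}$ is $(2k+1)$-ordered.
   Context: A graph $G$ is a bracelet graph if its vertex set can be partitioned into nonempty sets $V_1, \ldots, V_m$ with $m\geq 3$ (called the parts) such that two vertices $u\in V_i$ and $v\in V_j$ are adjacent if and only if $i-j\equiv 1$ or $-1 \pmod m$. A simple graph $G$ is $r$-ordered if, for every sequence $v_1, \ldots, v_r$ of $r$ distinct vertices of $G$, there exists a cycle in $G$ containing $v_1, \ldots, v_r$ in this (cyclic) order. -}

module Defs where

open import Data.Nat using (ℕ; suc; _≤_)
open import Data.Fin using (Fin; toℕ; _<_)
open import Data.Product using (Σ; _×_; ∃; ∃-syntax; proj₁; proj₂)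
open import Data.Sum using (_⊎_)
open import Relation.Binary.PropositionalEquality using (_≡_)
open import Function.Definitions using (Injective)

CycSucc : (l : ℕ) → Fin l → Fin l → Set
CycSucc l i j = (toℕ j ≡ suc (toℕ i)) ⊎ ((suc (toℕ i) ≡ l) × (toℕ j ≡ 0))

record Cycle {V : Set} (Adj : V → V → Set) (l : ℕ) : Set where
  field
    len≥3    : 3 ≤ l
    vertex   : Fin l → V
    distinct : Injective _≡_ _≡_ vertex
    adjacent : ∀ (i j : Fin l) → CycSucc l i j → Adj (vertex i) (vertex j)

-- G = (V, Adj) is r-ordered: for every sequence v₁,…,v_r of r distinct
-- vertices there is a cycle containing them in this cyclic order, i.e.
-- (after rotating the cycle) at strictly increasing positions.
Ordered : {V : Set} → (V → V → Set) → ℕ → Set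
Ordered {V} Adj r =
  ∀ (v : Fin r → V) → Injective _≡_ _≡_ v →
  ∃[ l ] Σ (Cycle Adj l) λ C →
    Σ (Fin r → Fin l) λ p → ((∀ t → Cycle.vertex C (p t) ≡ v t) ×
            (∀ s t → s < t → p s < p t))

-- The bracelet graph G_{k,m}: parts V_i = {i} × Fin k for i ∈ Fin m,
-- (i , a) ~ (j , b) iff i - j ≡ ±1 (mod m), i.e. j = i+1 or i = j+1 mod m.
BraceletVertex : ℕ → ℕ → Set
BraceletVertex k m = Fin m × Fin k

BraceletAdj : (k m : ℕ) → BraceletVertex k m → BraceletVertex k m → Set
BraceletAdj k m u w = CycSucc m (proj₁ u) (proj₁ w) ⊎ CycSucc m (proj₁ w) (proj₁ u)

{-# OPTIONS --safe #-}
-- Induction on k.  For k = 1 the three prescribed vertices lie in distinct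
-- parts, and going once around the parts in the right direction visits them in
-- order.  For k ≥ 2 call a part full if all k of its vertices are prescribed; as
-- 3k > 2k + 1 there are at most two full parts, so there are cyclically
-- consecutive prescribed vertices x, y in different parts whose parts include
-- every full part.  Then a transversal (one vertex per part) passes through x
-- and y and avoids all other prescribed vertices.  Removing it leaves a copy of
-- G_{k-1,m}, which by induction has a cycle through the remaining 2k - 1
-- vertices in order.  Finally x and y are spliced back in between their cyclic
-- neighbours u and w by a detour along the transversal: once around all parts,
-- or, when x and y lie in the parts of u and w, through two further transversal
-- vertices next to these parts, which is where m ≥ 4 is needed.
module Submission where

open import Defs
open import Data.Nat using (ℕ; _≤_; _+_; _*_)

open import Data.Empty using (⊥-elim)
open import Data.Fin using (Fin; zero; suc; toℕ; fromℕ; fromℕ<; inject₁; cast; punchIn; punchOut)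
  renaming (_<_ to _<ᶠ_)
open import Data.Fin.Properties
  using (_≟_; all?; ¬∀⟶∃¬; toℕ-injective; toℕ-fromℕ<; toℕ-fromℕ; toℕ-inject₁; toℕ<n; toℕ-cast;
         punchIn-injective; punchInᵢ≢i; punchIn-punchOut)
open import Data.List
  using (List; []; _∷_; _++_; [_]; map; length; reverse; lookup; tabulate; allFin; filter; initLast; _∷ʳ′_)
open import Data.List.Properties
  using (++-assoc; ++-identityʳ; map-++; length-++; length-map; length-tabulate; length-removeAt′;
         lookup-tabulate; unfold-reverse)
open import Data.List.Membership.Propositional using (_∈_; _∉_; find; lose)
open import Data.List.Membership.Propositional.Properties
  using (∈-++⁻; ∈-++⁺ʳ; ∈-map⁺; ∈-map⁻; ∈-lookup; ∈-∃++; ∈-allFin; ∈-filter⁺; ∈-filter⁻)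
open import Data.List.Relation.Binary.Disjoint.Propositional using (Disjoint)
open import Data.List.Relation.Binary.Permutation.Propositional
  using (_↭_; ↭⇒↭ₛ; ↭-refl; ↭-sym; ↭-trans; prep; module PermutationReasoning)
import Data.List.Relation.Binary.Permutation.Propositional.Properties as Perm
open Perm using (++-comm; ↭-reverse; ↭-length; ∈-resp-↭)
import Data.List.Relation.Binary.Permutation.Setoid.Properties as Permₛ
open import Data.List.Relation.Binary.Subset.Propositional using (_⊆_)
open import Data.List.Relation.Binary.Sublist.Propositional using ([]; _∷_; _∷ʳ_; from∈)
  renaming (_⊆_ to _⊑_)
open import Data.List.Relation.Binary.Sublist.Propositional.Properties
  using (∷ʳ⁻; ++⁺; ++⁺ˡ; ++⁺ʳ; map⁺; reverse⁺; length-mono-≤)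
open import Data.List.Relation.Unary.All as All using (All; []; _∷_)
open import Data.List.Relation.Unary.All.Properties using (All¬⇒¬Any)
import Data.List.Relation.Unary.AllPairs.Properties as AllPairs
open import Data.List.Relation.Unary.Any using (here; there; tail; any?; _─_)
open import Data.List.Relation.Unary.Unique.Propositional using (Unique; []; _∷_)
import Data.List.Relation.Unary.Unique.Propositional.Properties as Unique
open import Data.Nat using (zero; suc; z≤n; s≤s; _<_)
open import Data.Nat.Properties
  using (module ≤-Reasoning; _<?_; suc-injective; ≤-antisym; ≤-trans; ≤-reflexive; ≮⇒≥; <⇒≱; 1+n≰n;
         n≤1+n; m≤m+n; m≤n+m; +-suc; +-comm; +-identityʳ)
open import Data.Product using (Σ; ∃; ∃₂; _×_; _,_; proj₁; proj₂)
open import Data.Product.Properties using (≡-dec)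
open import Data.Sum as Sum using (_⊎_; inj₁; inj₂)
open import Data.Unit using (⊤)
open import Function using (_∘_; case_of_)
open import Function.Definitions using (Injective)
open import Relation.Binary.Construct.Closure.ReflexiveTransitive using (Star; ε; _◅_; _◅◅_)
open import Relation.Binary.Definitions using (DecidableEquality; Symmetric)
open import Relation.Binary.PropositionalEquality
  using (_≡_; _≢_; refl; sym; trans; cong; cong₂; subst; subst₂; ≢-sym; setoid; module ≡-Reasoning)
open import Relation.Nullary using (¬_; Dec; yes; no; ¬?; _×-dec_)
open import Relation.Nullary.Decidable using (decidable-stable)
open import Relation.Unary using (Decidable)

module _ {A : Set} where

  unique-++⁺ : ∀ {xs ys : List A} → Unique xs → Unique ys → Disjoint xs ys → Unique (xs ++ ys)
  unique-++⁺ {ys = ys} uxs uys disjoint = AllPairs.++⁺ uxs uys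
    (All.tabulate λ x∈xs → All.tabulate λ y∈ys x≡y → disjoint (x∈xs , subst (_∈ ys) (sym x≡y) y∈ys))

  unique-resp-↭ : ∀ {xs ys : List A} → xs ↭ ys → Unique xs → Unique ys
  unique-resp-↭ xs↭ys = Permₛ.Unique-resp-↭ (setoid A) (↭⇒↭ₛ xs↭ys)

  unique-drop-pair : ∀ {u x y : A} {L} → Unique (u ∷ x ∷ y ∷ L) →
                     Unique (u ∷ L) × x ∉ u ∷ L × y ∉ u ∷ L
  unique-drop-pair ((u≢x ∷ u≢y ∷ u∉L) ∷ (_ ∷ x∉L) ∷ y∉L ∷ uL) =
    u∉L ∷ uL , All¬⇒¬Any (≢-sym u≢x ∷ x∉L) , All¬⇒¬Any (≢-sym u≢y ∷ y∉L)

  lookup-injective : ∀ {xs : List A} → Unique xs → ∀ {i j} → lookup xs i ≡ lookup xs j → i ≡ j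
  lookup-injective (_ ∷ _)    {zero}  {zero}  _     = refl
  lookup-injective (x∉xs ∷ _) {zero}  {suc j} x≡xⱼ = ⊥-elim (All.lookup x∉xs (∈-lookup j) x≡xⱼ)
  lookup-injective (x∉xs ∷ _) {suc i} {zero}  xᵢ≡x = ⊥-elim (All.lookup x∉xs (∈-lookup i) (sym xᵢ≡x))
  lookup-injective (_ ∷ uxs)  {suc i} {suc j} xᵢ≡xⱼ = cong suc (lookup-injective uxs xᵢ≡xⱼ)

  ∈-─⁺ : ∀ {x y : A} {ys} (x∈ys : x ∈ ys) → y ∈ ys → y ≢ x → y ∈ (ys ─ x∈ys)
  ∈-─⁺ (here refl)  (here refl)  y≢x = ⊥-elim (y≢x refl)
  ∈-─⁺ (here refl)  (there y∈ys) _   = y∈ys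
  ∈-─⁺ (there _)    (here refl)  _   = here refl
  ∈-─⁺ (there x∈ys) (there y∈ys) y≢x = there (∈-─⁺ x∈ys y∈ys y≢x)

  unique⊆⇒length≤ : ∀ {xs ys : List A} → Unique xs → xs ⊆ ys → length xs ≤ length ys
  unique⊆⇒length≤ [] _ = z≤n
  unique⊆⇒length≤ {x ∷ xs} {ys} (x∉xs ∷ uxs) xs⊆ys = begin
    suc (length xs)          ≤⟨ s≤s (unique⊆⇒length≤ uxs xs⊆ys─x) ⟩
    suc (length (ys ─ x∈ys)) ≡⟨ sym (length-removeAt′ ys _) ⟩
    length ys                ∎
    where
    open ≤-Reasoning
    x∈ys = xs⊆ys (here refl)
    xs⊆ys─x : xs ⊆ (ys ─ x∈ys)
    xs⊆ys─x z∈xs = ∈-─⁺ x∈ys (xs⊆ys (there z∈xs)) (≢-sym (All.lookup x∉xs z∈xs))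

  ↭-unsplice : ∀ (u : A) B P C R → u ∷ (B ++ P ++ C) ++ R ↭ (B ++ C) ++ u ∷ P ++ R
  ↭-unsplice u B P C R = begin
    u ∷ (B ++ P ++ C) ++ R  ≡⟨ cong (u ∷_) (trans (++-assoc B (P ++ C) R) (cong (B ++_) (++-assoc P C R))) ⟩
    u ∷ B ++ P ++ C ++ R    ↭⟨ Perm.shift u B (P ++ C ++ R) ⟨
    B ++ u ∷ P ++ C ++ R    ↭⟨ Perm.++⁺ˡ B (prep u (Perm.shifts P C)) ⟩
    B ++ u ∷ C ++ P ++ R    ↭⟨ Perm.++⁺ˡ B (Perm.shift u C (P ++ R)) ⟨
    B ++ C ++ u ∷ P ++ R    ≡⟨ ++-assoc B C (u ∷ P ++ R) ⟨
    (B ++ C) ++ u ∷ P ++ R  ∎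
    where open PermutationReasoning

  ⊑-split : ∀ xs {ys W : List A} → xs ++ ys ⊑ W →
            ∃₂ λ W₁ W₂ → W ≡ W₁ ++ W₂ × xs ⊑ W₁ × ys ⊑ W₂
  ⊑-split [] {W = W} ys⊑W = [] , W , refl , [] , ys⊑W
  ⊑-split (x ∷ xs) (y ∷ʳ p) with W₁ , W₂ , refl , q , r ← ⊑-split (x ∷ xs) p =
    y ∷ W₁ , W₂ , refl , y ∷ʳ q , r
  ⊑-split (x ∷ xs) (refl ∷ p) with W₁ , W₂ , refl , q , r ← ⊑-split xs p =
    x ∷ W₁ , W₂ , refl , refl ∷ q , r

  ∷-⊑-split : ∀ {x : A} {xs W} → x ∷ xs ⊑ W → ∃₂ λ W₁ W₂ → W ≡ W₁ ++ x ∷ W₂ × xs ⊑ W₂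
  ∷-⊑-split (y ∷ʳ p) with W₁ , W₂ , refl , q ← ∷-⊑-split p = y ∷ W₁ , W₂ , refl , q
  ∷-⊑-split (refl ∷ p) = [] , _ , refl , p

  ⊑-++-middle : ∀ xs {ys zs us : List A} → us ⊑ xs ++ zs → us ⊑ xs ++ ys ++ zs
  ⊑-++-middle []       {ys} p = ++⁺ˡ ys p
  ⊑-++-middle (x ∷ xs) (.x ∷ʳ p) = x ∷ʳ ⊑-++-middle xs p
  ⊑-++-middle (x ∷ xs) (refl ∷ p) = refl ∷ ⊑-++-middle xs p

  ∈-pair-⊑ : ∀ {x y : A} {xs} → x ∈ xs → y ∈ xs → x ≢ y → x ∷ y ∷ [] ⊑ xs ⊎ y ∷ x ∷ [] ⊑ xs
  ∈-pair-⊑ (here refl) (here refl) x≢y = ⊥-elim (x≢y refl)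
  ∈-pair-⊑ (here refl) (there y∈xs) _ = inj₁ (refl ∷ from∈ y∈xs)
  ∈-pair-⊑ (there x∈xs) (here refl) _ = inj₂ (refl ∷ from∈ x∈xs)
  ∈-pair-⊑ {xs = z ∷ _} (there x∈xs) (there y∈xs) x≢y =
    Sum.map (z ∷ʳ_) (z ∷ʳ_) (∈-pair-⊑ x∈xs y∈xs x≢y)

  index⊑ : ∀ {xs ys : List A} → xs ⊑ ys → Fin (length xs) → Fin (length ys)
  index⊑ (y ∷ʳ p)   i       = suc (index⊑ p i)
  index⊑ (refl ∷ p) zero    = zero
  index⊑ (refl ∷ p) (suc i) = suc (index⊑ p i)

  lookup-index⊑ : ∀ {xs ys : List A} (p : xs ⊑ ys) i → lookup ys (index⊑ p i) ≡ lookup xs i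
  lookup-index⊑ (y ∷ʳ p)   i       = lookup-index⊑ p i
  lookup-index⊑ (refl ∷ p) zero    = refl
  lookup-index⊑ (refl ∷ p) (suc i) = lookup-index⊑ p i

  index⊑-mono : ∀ {xs ys : List A} (p : xs ⊑ ys) {i j} → i <ᶠ j → index⊑ p i <ᶠ index⊑ p j
  index⊑-mono (y ∷ʳ p)   i<j = s≤s (index⊑-mono p i<j)
  index⊑-mono (refl ∷ p) {zero}  {suc j} _         = s≤s z≤n
  index⊑-mono (refl ∷ p) {suc i} {suc j} (s≤s i<j) = s≤s (index⊑-mono p i<j)

  data Rotation : List A → List A → Set where
    rotate : ∀ xs ys → Rotation (xs ++ ys) (ys ++ xs)

  rotations⇒↭ : ∀ {xs ys : List A} → Star Rotation xs ys → xs ↭ ys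
  rotations⇒↭ ε                  = ↭-refl
  rotations⇒↭ (rotate xs ys ◅ rs) = ↭-trans (++-comm xs ys) (rotations⇒↭ rs)

  Straddles : (A → Set) → A → A → Set
  Straddles S x y = (S x × ¬ S y) ⊎ (¬ S x × S y)

  record StraddlingPair (S : A → Set) (L : List A) : Set where
    constructor straddling
    field
      before after : List A
      x y          : A
      split        : L ≡ before ++ x ∷ y ∷ after
      straddles    : Straddles S x y

  straddling-∷ : ∀ {S L} c → StraddlingPair S L → StraddlingPair S (c ∷ L)
  straddling-∷ c (straddling P Q x y L≡ s) = straddling (c ∷ P) Q x y (cong (c ∷_) L≡) s

  straddling-∷∷ : ∀ {S : A → Set} {c d L} → Dec (S c) → Dec (S d) →
                  (S c → S d → StraddlingPair S (d ∷ L)) → (¬ S c → ¬ S d → StraddlingPair S (d ∷ L)) →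
                  StraddlingPair S (c ∷ d ∷ L)
  straddling-∷∷ {c = c} {d} {L} (yes sc) (no ¬sd) _ _ = straddling [] L c d refl (inj₁ (sc , ¬sd))
  straddling-∷∷ {c = c} {d} {L} (no ¬sc) (yes sd) _ _ = straddling [] L c d refl (inj₂ (¬sc , sd))
  straddling-∷∷ {c = c} (yes sc) (yes sd) both _       = straddling-∷ c (both sc sd)
  straddling-∷∷ {c = c} (no ¬sc) (no ¬sd) _ neither    = straddling-∷ c (neither ¬sc ¬sd)

  ∃-straddling-pair : ∀ {S : A → Set} → Decidable S → ∀ (L : List A) {z z'} →
                      z ∈ L → S z → z' ∈ L → ¬ S z' → StraddlingPair S L
  ∃-straddling-pair S? (c ∷ []) (here refl) sz (here refl) ¬sz' = ⊥-elim (¬sz' sz)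
  ∃-straddling-pair S? (c ∷ d ∷ L) z∈ sz z'∈ ¬sz' = straddling-∷∷ (S? c) (S? d)
    (λ sc sd → ∃-straddling-pair S? (d ∷ L) (here refl) sd (tail (λ { refl → ¬sz' sc }) z'∈) ¬sz')
    (λ ¬sc ¬sd → ∃-straddling-pair S? (d ∷ L) (tail (λ { refl → ¬sc sz }) z∈) sz (here refl) ¬sd)

-- Walks and closed walks

module _ {A : Set} (R : A → A → Set) where

  data Chain : A → List A → A → Set where
    end : ∀ {x z} → R x z → Chain x [] z
    _∷_ : ∀ {x y ys z} → R x y → Chain y ys z → Chain x (y ∷ ys) z

  Cyclic : List A → Set
  Cyclic []       = ⊤
  Cyclic (x ∷ xs) = Chain x xs x

module _ {A : Set} {R : A → A → Set} where

  chain-++ : ∀ {x ys y zs z} → Chain R x ys y → Chain R y zs z → Chain R x (ys ++ y ∷ zs) z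
  chain-++ (end r)  c  = r ∷ c
  chain-++ (r ∷ c₁) c₂ = r ∷ chain-++ c₁ c₂

  chain-split : ∀ {x} ys {y zs z} → Chain R x (ys ++ y ∷ zs) z → Chain R x ys y × Chain R y zs z
  chain-split []       (r ∷ c) = end r , c
  chain-split (_ ∷ ys) (r ∷ c) = let c₁ , c₂ = chain-split ys c in r ∷ c₁ , c₂

  cyclic-rotate : ∀ xs ys → Cyclic R (xs ++ ys) → Cyclic R (ys ++ xs)
  cyclic-rotate []       ys       c = subst (Cyclic R) (sym (++-identityʳ ys)) c
  cyclic-rotate (x ∷ xs) []       c = subst (Cyclic R) (++-identityʳ (x ∷ xs)) c
  cyclic-rotate (x ∷ xs) (y ∷ ys) c = let c₁ , c₂ = chain-split xs c in chain-++ c₂ c₁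

  chain-reverse : Symmetric R → ∀ {x ys z} → Chain R x ys z → Chain R z (reverse ys) x
  chain-reverse sym-R (end r) = end (sym-R r)
  chain-reverse sym-R {x} {y ∷ ys} {z} (r ∷ c) = subst (λ L → Chain R z L x) (sym (unfold-reverse y ys))
    (chain-++ (chain-reverse sym-R c) (end (sym-R r)))

  chain-map : ∀ {B : Set} {S : B → B → Set} (f : B → A) → (∀ {a b} → S a b → R (f a) (f b)) →
              ∀ {x ys z} → Chain S x ys z → Chain R (f x) (map f ys) (f z)
  chain-map f f-hom (end r) = end (f-hom r)
  chain-map f f-hom (r ∷ c) = f-hom r ∷ chain-map f f-hom c

  cyclic-map : ∀ {B : Set} {S : B → B → Set} (f : B → A) → (∀ {a b} → S a b → R (f a) (f b)) →
               ∀ {xs} → Cyclic S xs → Cyclic R (map f xs)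
  cyclic-map f f-hom {[]}    _ = _
  cyclic-map f f-hom {_ ∷ _} c = chain-map f f-hom c

  chain-tabulate : ∀ {k} (f : Fin (suc k) → A) {z} → (∀ i → R (f (inject₁ i)) (f (suc i))) →
                   R (f (fromℕ k)) z → Chain R (f zero) (tabulate (f ∘ suc)) z
  chain-tabulate {zero}  f _    last = end last
  chain-tabulate {suc k} f step last = step zero ∷ chain-tabulate (f ∘ suc) (step ∘ suc) last

  chain-lookup : ∀ {x L z} → Chain R x L z → ∀ (i j : Fin (length (x ∷ L))) → toℕ j ≡ suc (toℕ i) →
                 R (lookup (x ∷ L) i) (lookup (x ∷ L) j)
  chain-lookup (r ∷ c) zero    (suc zero) _     = r
  chain-lookup (r ∷ c) (suc i) (suc j)    j≡1+i = chain-lookup c i j (suc-injective j≡1+i)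

  chain-lookup-last : ∀ {x L z} → Chain R x L z → ∀ (i : Fin (length (x ∷ L))) →
                      suc (toℕ i) ≡ length (x ∷ L) → R (lookup (x ∷ L) i) z
  chain-lookup-last (end r) zero    _       = r
  chain-lookup-last (r ∷ c) (suc i) 1+i≡len = chain-lookup-last c i (suc-injective 1+i≡len)

  cyclic-lookup : ∀ {W} → Cyclic R W → ∀ (i j : Fin (length W)) → CycSucc (length W) i j →
                  R (lookup W i) (lookup W j)
  cyclic-lookup {_ ∷ _} c i j    (inj₁ j≡1+i)        = chain-lookup c i j j≡1+i
  cyclic-lookup {_ ∷ _} c i zero (inj₂ (1+i≡len , _)) = chain-lookup-last c i 1+i≡len

-- The cycle formed by the parts

Neighbour : ∀ {m} → Fin m → Fin m → Set
Neighbour {m} i j = CycSucc m i j ⊎ CycSucc m j i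

neighbour-sym : ∀ {m} → Symmetric (Neighbour {m})
neighbour-sym = Sum.swap

-- CycSucc m i j unfolds to CycStep m (toℕ i) (toℕ j); stated over ℕ, the case
-- analyses below are carried out by matching on refl.
CycStep : ℕ → ℕ → ℕ → Set
CycStep m a b = (b ≡ suc a) ⊎ ((suc a ≡ m) × (b ≡ 0))

cycStep-≢₁ : ∀ {m a b} → 2 ≤ m → CycStep m a b → a ≢ b
cycStep-≢₁ _             (inj₁ refl)          ()
cycStep-≢₁ (s≤s (s≤s _)) (inj₂ (refl , refl)) ()

cycStep-≢₂ : ∀ {m a b c} → 3 ≤ m → CycStep m a b → CycStep m b c → a ≢ c
cycStep-≢₂ _                   (inj₁ refl)          (inj₁ refl)          ()
cycStep-≢₂ (s≤s (s≤s (s≤s _))) (inj₁ refl)          (inj₂ (refl , refl)) ()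
cycStep-≢₂ (s≤s (s≤s (s≤s _))) (inj₂ (refl , refl)) (inj₁ refl)          ()
cycStep-≢₂ (s≤s (s≤s _))       (inj₂ (refl , refl)) (inj₂ (() , refl))

cycStep-≢₃ : ∀ {m a b c d} → 4 ≤ m → CycStep m a b → CycStep m b c → CycStep m c d → a ≢ d
cycStep-≢₃ _ (inj₁ refl) (inj₁ refl) (inj₁ refl) ()
cycStep-≢₃ (s≤s (s≤s (s≤s (s≤s _)))) (inj₁ refl) (inj₁ refl) (inj₂ (refl , refl)) ()
cycStep-≢₃ (s≤s (s≤s (s≤s (s≤s _)))) (inj₁ refl) (inj₂ (refl , refl)) (inj₁ refl) ()
cycStep-≢₃ _ (inj₁ refl) (inj₂ (refl , refl)) (inj₂ (() , refl))
cycStep-≢₃ (s≤s (s≤s (s≤s (s≤s _)))) (inj₂ (refl , refl)) (inj₁ refl) (inj₁ refl) ()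
cycStep-≢₃ (s≤s (s≤s (s≤s (s≤s _)))) (inj₂ (refl , refl)) (inj₁ refl) (inj₂ (() , refl))
cycStep-≢₃ (s≤s (s≤s (s≤s (s≤s _)))) (inj₂ (refl , refl)) (inj₂ (() , refl)) _

cycSucc-≢ : ∀ {m} {i j : Fin m} → 2 ≤ m → CycSucc m i j → i ≢ j
cycSucc-≢ 2≤m i→j = cycStep-≢₁ 2≤m i→j ∘ cong toℕ

cycSucc-injective : ∀ {m} {i i' j : Fin m} → CycSucc m i j → CycSucc m i' j → i ≡ i'
cycSucc-injective (inj₁ j≡1+i) (inj₁ j≡1+i') = toℕ-injective (suc-injective (trans (sym j≡1+i) j≡1+i'))
cycSucc-injective (inj₁ j≡1+i) (inj₂ (_ , j≡0)) with () ← trans (sym j≡1+i) j≡0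
cycSucc-injective (inj₂ (_ , j≡0)) (inj₁ j≡1+i') with () ← trans (sym j≡1+i') j≡0
cycSucc-injective (inj₂ (1+i≡m , _)) (inj₂ (1+i'≡m , _)) =
  toℕ-injective (suc-injective (trans 1+i≡m (sym 1+i'≡m)))

module _ {n : ℕ} where

  sucᶜ : Fin (suc n) → Fin (suc n)
  sucᶜ i with suc (toℕ i) <? suc n
  ... | yes i+1<m = fromℕ< i+1<m
  ... | no _      = zero

  sucᶜ-cycSucc : ∀ i → CycSucc (suc n) i (sucᶜ i)
  sucᶜ-cycSucc i with suc (toℕ i) <? suc n
  ... | yes i+1<m = inj₁ (toℕ-fromℕ< i+1<m)
  ... | no i+1≮m  = inj₂ (≤-antisym (toℕ<n i) (≮⇒≥ i+1≮m) , refl)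

  predᶜ : Fin (suc n) → Fin (suc n)
  predᶜ zero    = fromℕ n
  predᶜ (suc i) = inject₁ i

  predᶜ-cycSucc : ∀ i → CycSucc (suc n) (predᶜ i) i
  predᶜ-cycSucc zero    = inj₂ (cong suc (toℕ-fromℕ n) , refl)
  predᶜ-cycSucc (suc i) = inj₁ (cong suc (sym (toℕ-inject₁ i)))

  consecutive₄-unique : 4 ≤ suc n → ∀ a → Unique (predᶜ a ∷ a ∷ sucᶜ a ∷ sucᶜ (sucᶜ a) ∷ [])
  consecutive₄-unique 4≤m a =
    (≢₁ s₀ ∷ ≢₂ s₀ s₁ ∷ ≢₃ s₀ s₁ s₂ ∷ []) ∷ (≢₁ s₁ ∷ ≢₂ s₁ s₂ ∷ []) ∷ (≢₁ s₂ ∷ []) ∷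
    [] ∷ []
    where
    s₀ = predᶜ-cycSucc a
    s₁ = sucᶜ-cycSucc a
    s₂ = sucᶜ-cycSucc (sucᶜ a)
    3≤m = ≤-trans (n≤1+n 3) 4≤m
    ≢₁ : ∀ {i j} → CycSucc (suc n) i j → i ≢ j
    ≢₁ = cycSucc-≢ (≤-trans (n≤1+n 2) 3≤m)
    ≢₂ : ∀ {i j k} → CycSucc (suc n) i j → CycSucc (suc n) j k → i ≢ k
    ≢₂ s t = cycStep-≢₂ 3≤m s t ∘ cong toℕ
    ≢₃ : ∀ {i j k l} → CycSucc (suc n) i j → CycSucc (suc n) j k → CycSucc (suc n) k l → i ≢ l
    ≢₃ s t u = cycStep-≢₃ 4≤m s t u ∘ cong toℕ

  detour-ends : 4 ≤ suc n → ∀ {a b : Fin (suc n)} → a ≢ b →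
                ∃₂ λ e f → Neighbour a e × Neighbour b f × Unique (e ∷ a ∷ b ∷ f ∷ [])
  detour-ends 4≤m {a} {b} a≢b with b ≟ sucᶜ a | a ≟ sucᶜ b
  ... | yes refl | _ =
    predᶜ a , sucᶜ b , inj₂ (predᶜ-cycSucc a) , inj₁ (sucᶜ-cycSucc b) , consecutive₄-unique 4≤m a
  ... | no _ | yes refl =
    sucᶜ a , predᶜ b , inj₁ (sucᶜ-cycSucc a) , inj₂ (predᶜ-cycSucc b) ,
    unique-resp-↭ (↭-sym (↭-reverse _)) (consecutive₄-unique 4≤m b)
  ... | no b≢a⁺ | no a≢b⁺ =
    sucᶜ a , sucᶜ b , inj₁ (sucᶜ-cycSucc a) , inj₁ (sucᶜ-cycSucc b) ,
    (≢-sym (≢⁺ a) ∷ ≢-sym b≢a⁺ ∷ a⁺≢b⁺ ∷ []) ∷ (a≢b ∷ a≢b⁺ ∷ []) ∷ (≢⁺ b ∷ []) ∷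
    [] ∷ []
    where
    ≢⁺ : ∀ i → i ≢ sucᶜ i
    ≢⁺ i = cycSucc-≢ (≤-trans (s≤s (s≤s z≤n)) 4≤m) (sucᶜ-cycSucc i)
    a⁺≢b⁺ : sucᶜ a ≢ sucᶜ b
    a⁺≢b⁺ a⁺≡b⁺ = a≢b (cycSucc-injective (sucᶜ-cycSucc a)
                                         (subst (CycSucc (suc n) b) (sym a⁺≡b⁺) (sucᶜ-cycSucc b)))

  allFin-cyclic : Cyclic Neighbour (allFin (suc n))
  allFin-cyclic = chain-tabulate (λ i → i) (λ i → inj₁ (inj₁ (cong suc (sym (toℕ-inject₁ i)))))
                                 (inj₁ (inj₂ (cong suc (toℕ-fromℕ n) , refl)))

  record Round (p : Fin (suc n)) (R : List (Fin (suc n))) : Set where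
    field
      unique   : Unique (p ∷ R)
      chain    : Chain Neighbour p R p
      complete : ∀ i → i ∈ p ∷ R

  round : ∀ p → ∃ (Round p)
  round p with A , B , allFin≡ ← ∈-∃++ (∈-allFin p) = B ++ A , record
    { unique   = unique-resp-↭ (++-comm A (p ∷ B)) (subst Unique allFin≡ (Unique.allFin⁺ (suc n)))
    ; chain    = cyclic-rotate A (p ∷ B) (subst (Cyclic Neighbour) allFin≡ allFin-cyclic)
    ; complete = λ i → ∈-resp-↭ (++-comm A (p ∷ B)) (subst (i ∈_) allFin≡ (∈-allFin i))
    }

  round-reverse : ∀ {p R} → Round p R → Round p (reverse R)
  round-reverse {p} {R} ρ = record
    { unique   = unique-resp-↭ p∷R↭ unique
    ; chain    = chain-reverse neighbour-sym chain
    ; complete = ∈-resp-↭ p∷R↭ ∘ complete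
    }
    where
    open Round ρ
    p∷R↭ = prep p (↭-sym (↭-reverse R))

  round-through : ∀ p {x y} → x ≢ y → y ≢ p → ∃ λ R → Round p R × x ∷ y ∷ [] ⊑ p ∷ R
  round-through p {x} {y} x≢y y≢p with R , ρ ← round p
    with ∈-pair-⊑ (Round.complete ρ x) (Round.complete ρ y) x≢y
  ... | inj₁ xy⊑ = R , ρ , xy⊑
  ... | inj₂ yx⊑ = reverse R , round-reverse ρ , p ∷ʳ reverse⁺ (∷ʳ⁻ y≢p yx⊑)

-- Cycles of the bracelet graph through given vertices

module _ {m K : ℕ} where

  part : BraceletVertex K m → Fin m
  part = proj₁

  -- Adjacency in the bracelet graph only depends on the parts.
  chain-reanchor : ∀ {x L z i j} → Chain (BraceletAdj K m) x L z → Chain (BraceletAdj K m) (part x , i) L (part z , j)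
  chain-reanchor (end adj) = end adj
  chain-reanchor (adj ∷ c) = adj ∷ chain-reanchor c

  record CycleThrough (ts : List (BraceletVertex K m)) : Set where
    constructor cycleThrough
    field
      walk    : List (BraceletVertex K m)
      unique  : Unique walk
      cyclic  : Cyclic (BraceletAdj K m) walk
      through : ts ⊑ walk

  cycleThrough-rotate : ∀ xs {ys} → CycleThrough (xs ++ ys) → CycleThrough (ys ++ xs)
  cycleThrough-rotate xs (cycleThrough W uW cW ts⊑W)
    with W₁ , W₂ , refl , xs⊑W₁ , ys⊑W₂ ← ⊑-split xs ts⊑W =
    cycleThrough (W₂ ++ W₁) (unique-resp-↭ (++-comm W₁ W₂) uW) (cyclic-rotate W₁ W₂ cW)
                 (++⁺ ys⊑W₂ xs⊑W₁)

  cycleThrough-rotations : ∀ {ts ts'} → Star Rotation ts ts' → CycleThrough ts' → CycleThrough ts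
  cycleThrough-rotations ε                   C = C
  cycleThrough-rotations (rotate xs ys ◅ rs) C = cycleThrough-rotate ys (cycleThrough-rotations rs C)

  cycleThrough⇒ordered : ∀ {r} → 3 ≤ r →
    (∀ (v : Fin r → BraceletVertex K m) → Injective _≡_ _≡_ v → CycleThrough (tabulate v)) →
    Ordered (BraceletAdj K m) r
  cycleThrough⇒ordered {r} 3≤r through-all v v-injective =
    length W , cycle , position , lookup-position , position-mono
    where
    open CycleThrough (through-all v v-injective) renaming (walk to W)
    r≡ = sym (length-tabulate v)
    cycle : Cycle (BraceletAdj K m) (length W)
    cycle = record
      { len≥3    = ≤-trans 3≤r (≤-trans (≤-reflexive r≡) (length-mono-≤ through))
      ; vertex   = lookup W
      ; distinct = lookup-injective unique
      ; adjacent = cyclic-lookup cyclic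
      }
    position : Fin r → Fin (length W)
    position t = index⊑ through (cast r≡ t)
    lookup-position : ∀ t → lookup W (position t) ≡ v t
    lookup-position t = trans (lookup-index⊑ through (cast r≡ t)) (lookup-tabulate v t)
    position-mono : ∀ s t → s <ᶠ t → position s <ᶠ position t
    position-mono s t s<t = index⊑-mono through (subst₂ _<_ (sym (toℕ-cast r≡ s)) (sym (toℕ-cast r≡ t)) s<t)

-- Transversals

module _ {m K : ℕ} (ℓ : Fin m → Fin K) where

  transversal : Fin m → BraceletVertex K m
  transversal i = i , ℓ i

  OffTransversal : BraceletVertex K m → Set
  OffTransversal v = proj₂ v ≢ ℓ (proj₁ v)

  transversal-injective : ∀ {i j} → transversal i ≡ transversal j → i ≡ j
  transversal-injective = cong proj₁

  transversal-disjoint : ∀ {W} → (∀ {v} → v ∈ W → OffTransversal v) → ∀ I → Disjoint (map transversal I) W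
  transversal-disjoint off I (v∈I , v∈W) with _ , _ , refl ← ∈-map⁻ transversal v∈I = off v∈W refl

  ∉-transversal⇒off : ∀ {ts} → (∀ i → transversal i ∉ ts) → ∀ {v} → v ∈ ts → OffTransversal v
  ∉-transversal⇒off T∉ts {i , _} v∈ts refl = T∉ts i v∈ts

choose-transversal : ∀ {m K} {ts : List (BraceletVertex K m)} {x y} → part x ≢ part y → x ∉ ts → y ∉ ts →
  (∀ i → i ≢ part x → i ≢ part y → ∃ λ j → (i , j) ∉ ts) →
  ∃ λ ℓ → ℓ (part x) ≡ proj₂ x × ℓ (part y) ≡ proj₂ y × (∀ i → transversal ℓ i ∉ ts)
choose-transversal {m} {K} {ts} {x} {y} x≢y x∉ y∉ free = ℓ , ℓ-at-x (part x) refl , ℓ-at-y (part y) refl , T∉ts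
  where
  layer : ∀ i → Σ (Fin K) λ j →
          (i , j) ∉ ts × (i ≡ part x → j ≡ proj₂ x) × (i ≡ part y → j ≡ proj₂ y)
  layer i with i ≟ part x | i ≟ part y
  ... | yes refl | _        = proj₂ x , x∉ , (λ _ → refl) , ⊥-elim ∘ x≢y
  ... | no i≢x   | yes refl = proj₂ y , y∉ , ⊥-elim ∘ i≢x , (λ _ → refl)
  ... | no i≢x   | no i≢y   with j , j∉ ← free i i≢x i≢y = j , j∉ , ⊥-elim ∘ i≢x , ⊥-elim ∘ i≢y
  ℓ : Fin m → Fin K
  ℓ = proj₁ ∘ layer
  T∉ts : ∀ i → transversal ℓ i ∉ ts
  T∉ts = proj₁ ∘ proj₂ ∘ layer
  ℓ-at-x : ∀ i → i ≡ part x → ℓ i ≡ proj₂ x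
  ℓ-at-x = proj₁ ∘ proj₂ ∘ proj₂ ∘ layer
  ℓ-at-y : ∀ i → i ≡ part y → ℓ i ≡ proj₂ y
  ℓ-at-y = proj₂ ∘ proj₂ ∘ proj₂ ∘ layer

-- punchIn (ℓ i) embeds the K layers of part i into K + 1 layers skipping layer ℓ i,
-- so G_{K,m} is G_{K+1,m} with the transversal ℓ removed.
module _ {m K : ℕ} (ℓ : Fin m → Fin (suc K)) where

  raise : BraceletVertex K m → BraceletVertex (suc K) m
  raise (i , j) = i , punchIn (ℓ i) j

  raise-injective : ∀ {v v'} → raise v ≡ raise v' → v ≡ v'
  raise-injective {i , j} {_ , j'} raise≡ with refl ← cong proj₁ raise≡ =
    cong (i ,_) (punchIn-injective (ℓ i) j j' (cong proj₂ raise≡))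

  raise-onto : ∀ L → (∀ {v} → v ∈ L → OffTransversal ℓ v) → ∃ λ L' → map raise L' ≡ L
  raise-onto []            _   = [] , refl
  raise-onto ((i , j) ∷ L) off with L' , refl ← raise-onto L (off ∘ there) =
    (i , punchOut (≢-sym (off (here refl)))) ∷ L' , cong (λ j' → (i , j') ∷ map raise L') (punchIn-punchOut _)

  raise-cycleThrough : ∀ {ts' ts} → map raise ts' ≡ ts → CycleThrough ts' →
    Σ (CycleThrough ts) λ C → ∀ {v} → v ∈ CycleThrough.walk C → OffTransversal ℓ v
  raise-cycleThrough refl (cycleThrough W uW cW ts'⊑W) =
    cycleThrough (map raise W) (Unique.map⁺ raise-injective uW) (cyclic-map raise (λ adj → adj) cW)
                 (map⁺ raise ts'⊑W) ,
    off
    where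
    off : ∀ {v} → v ∈ map raise W → OffTransversal ℓ v
    off v∈ with (i , j) , _ , refl ← ∈-map⁻ raise v∈ = punchInᵢ≢i (ℓ i) j

-- Splicing two transversal vertices into a cycle

module _ {n K : ℕ} (ℓ : Fin (suc n) → Fin K) where

  private
    Vertex = BraceletVertex K (suc n)
    Adj    = BraceletAdj K (suc n)
    T      = transversal ℓ

  lift-round : ∀ {p R} → Round p R → Chain Adj (T p) (map T R) (T p)
  lift-round ρ = chain-map T (λ adj → adj) (Round.chain ρ)

  record Detour (u w : Vertex) (P : List Vertex) (x y : Fin (suc n)) : Set where
    field
      before after : List (Fin (suc n))
      distinct     : Unique (before ++ after)
      ordered      : x ∷ y ∷ [] ⊑ before ++ after
      chain        : Chain Adj u (map T before ++ P ++ map T after) w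

  detour-after : ∀ {u w P x y} → x ≢ y → y ≢ part w → Chain Adj u P w → Detour u w P x y
  detour-after {w = w} x≢y y≢b c with R , ρ , xy⊑ ← round-through (part w) x≢y y≢b = record
    { before   = []
    ; after    = part w ∷ R
    ; distinct = Round.unique ρ
    ; ordered  = xy⊑
    ; chain    = chain-++ (chain-reanchor c) (chain-reanchor (lift-round ρ))
    }

  detour-before : ∀ {u w P x y} → x ≢ y → x ≢ part u → Chain Adj u P w → Detour u w P x y
  detour-before {u} {w} {P} x≢y x≢a c with R , ρ , yx⊑ ← round-through (part u) (≢-sym x≢y) x≢a = record
    { before   = reverse R ++ [ a ]
    ; after    = []
    ; distinct = subst Unique (sym reversed≡) (unique-resp-↭ (↭-sym (↭-reverse (a ∷ R))) (Round.unique ρ))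
    ; ordered  = subst (_ ⊑_) (sym reversed≡) (reverse⁺ yx⊑)
    ; chain    = subst (λ L → Chain Adj u L w) (sym mapped≡)
                   (chain-++ (chain-reanchor (lift-round (round-reverse ρ))) (chain-reanchor c))
    }
    where
    open ≡-Reasoning
    a = part u
    reversed≡ : (reverse R ++ [ a ]) ++ [] ≡ reverse (a ∷ R)
    reversed≡ = trans (++-identityʳ _) (sym (unfold-reverse a R))
    mapped≡ : map T (reverse R ++ [ a ]) ++ P ++ [] ≡ map T (reverse R) ++ T a ∷ P
    mapped≡ = begin
      map T (reverse R ++ [ a ]) ++ P ++ []  ≡⟨ cong₂ _++_ (map-++ T (reverse R) [ a ]) (++-identityʳ P) ⟩
      (map T (reverse R) ++ [ T a ]) ++ P    ≡⟨ ++-assoc (map T (reverse R)) [ T a ] P ⟩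
      map T (reverse R) ++ T a ∷ P           ∎

  detour-around : 4 ≤ suc n → ∀ {u w P} → part u ≢ part w → Chain Adj u P w → Detour u w P (part u) (part w)
  detour-around 4≤m a≢b c with e , f , a~e , b~f , distinct ← detour-ends 4≤m a≢b = record
    { before   = e ∷ _ ∷ []
    ; after    = _ ∷ f ∷ []
    ; distinct = distinct
    ; ordered  = e ∷ʳ refl ∷ refl ∷ f ∷ʳ []
    ; chain    = a~e ∷ neighbour-sym a~e ∷ chain-++ (chain-reanchor c) (b~f ∷ end (neighbour-sym b~f))
    }

  detour : 4 ≤ suc n → ∀ {u w P} x y → x ≢ y → Chain Adj u P w → Detour u w P x y
  detour 4≤m {u} {w} x y x≢y c with y ≟ part w | x ≟ part u
  ... | no y≢b   | _        = detour-after x≢y y≢b c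
  ... | yes refl | no x≢a   = detour-before x≢y x≢a c
  ... | yes refl | yes refl = detour-around 4≤m x≢y c

  insert : 4 ≤ suc n → ∀ {u w rest} (C : CycleThrough (u ∷ w ∷ rest)) →
           (∀ {v} → v ∈ CycleThrough.walk C → OffTransversal ℓ v) →
           ∀ {x y} → x ≢ y → CycleThrough (u ∷ T x ∷ T y ∷ w ∷ rest)
  insert 4≤m {u} {w} {rest} (cycleThrough W uW cW u∷w∷rest⊑W) off {x} {y} x≢y
    with A , _ , refl , w∷rest⊑ ← ∷-⊑-split u∷w∷rest⊑W
    with P , B , refl , rest⊑B ← ∷-⊑-split w∷rest⊑ =
    cycleThrough (u ∷ X ++ w ∷ Q) unique (chain-++ chain w→u) (refl ∷ ++⁺ xy⊑X (refl ∷ ++⁺ʳ A rest⊑B))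
    where
    Q = B ++ A
    rotated≡ : (u ∷ P ++ w ∷ B) ++ A ≡ u ∷ P ++ w ∷ Q
    rotated≡ = cong (u ∷_) (++-assoc P (w ∷ B) A)
    rotated↭ : u ∷ P ++ w ∷ Q ↭ A ++ u ∷ P ++ w ∷ B
    rotated↭ = subst (_↭ A ++ u ∷ P ++ w ∷ B) rotated≡ (++-comm (u ∷ P ++ w ∷ B) A)
    u→w→u = chain-split P (subst (Cyclic Adj) rotated≡ (cyclic-rotate A (u ∷ P ++ w ∷ B) cW))
    w→u = proj₂ u→w→u
    open Detour (detour 4≤m x y x≢y (proj₁ u→w→u))
    X = map T before ++ P ++ map T after
    xy⊑X : T x ∷ T y ∷ [] ⊑ X
    xy⊑X = ⊑-++-middle (map T before) (subst (_ ⊑_) (map-++ T before after) (map⁺ T ordered))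
    unique : Unique (u ∷ X ++ w ∷ Q)
    unique = unique-resp-↭ (↭-sym (↭-unsplice u (map T before) P (map T after) (w ∷ Q)))
      (subst (λ L → Unique (L ++ u ∷ P ++ w ∷ Q)) (map-++ T before after)
        (unique-++⁺ (Unique.map⁺ (transversal-injective ℓ) distinct) (unique-resp-↭ (↭-sym rotated↭) uW)
                    (transversal-disjoint ℓ (off ∘ ∈-resp-↭ rotated↭) (before ++ after))))

-- Full parts and the choice of the removed pair

module _ {m K : ℕ} where

  private
    Vertex = BraceletVertex K m

  _≟ᵛ_ : DecidableEquality Vertex
  _≟ᵛ_ = ≡-dec _≟_ _≟_

  open import Data.List.Membership.DecPropositional _≟ᵛ_ using (_∈?_)

  Full : List Vertex → Fin m → Set
  Full ts i = ∀ j → (i , j) ∈ ts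

  full? : ∀ ts → Decidable (Full ts)
  full? ts i = all? λ j → (i , j) ∈? ts

  ¬full⇒free : ∀ {ts i} → ¬ Full ts i → ∃ λ j → (i , j) ∉ ts
  ¬full⇒free {ts} {i} = ¬∀⟶∃¬ K _ (λ j → (i , j) ∈? ts)

  block : Fin m → List Vertex
  block i = map (i ,_) (allFin K)

  length-block : ∀ i → length (block i) ≡ K
  length-block i = trans (length-map (i ,_) (allFin K)) (length-tabulate (λ j → j))

  block-unique : ∀ i → Unique (block i)
  block-unique i = Unique.map⁺ (cong proj₂) (Unique.allFin⁺ K)

  ∈-block : ∀ {v} → v ∈ block (part v)
  ∈-block {i , j} = ∈-map⁺ (i ,_) (∈-allFin j)

  block-part : ∀ {i v} → v ∈ block i → part v ≡ i
  block-part {i} v∈ with _ , _ , refl ← ∈-map⁻ (i ,_) v∈ = refl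

  ∃-outside-part : ∀ {ts} → Unique ts → K < length ts → ∀ i → ∃ λ v → v ∈ ts × part v ≢ i
  ∃-outside-part {ts} uts K<len i with any? (λ v → ¬? (part v ≟ i)) ts
  ... | yes outside = find outside
  ... | no none = ⊥-elim (<⇒≱ K<len (subst (length ts ≤_) (length-block i) (unique⊆⇒length≤ uts ts⊆block)))
    where
    ts⊆block : ts ⊆ block i
    ts⊆block {v} v∈ = subst (λ j → v ∈ block j) (decidable-stable (part v ≟ i) (none ∘ lose v∈)) ∈-block

  Outside : Fin m → Fin m → Vertex → Set
  Outside P Q v = part v ≢ P × part v ≢ Q

  outside? : ∀ P Q → Decidable (Outside P Q)
  outside? P Q v = ¬? (part v ≟ P) ×-dec ¬? (part v ≟ Q)

  ¬outside : ∀ {P Q v} → ¬ Outside P Q v → part v ≡ P ⊎ part v ≡ Q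
  ¬outside {P} {Q} {v} inside with part v ≟ P | part v ≟ Q
  ... | yes v∈P | _       = inj₁ v∈P
  ... | no _    | yes v∈Q = inj₂ v∈Q
  ... | no v∉P  | no v∉Q  = ⊥-elim (inside (v∉P , v∉Q))

  -- Two full parts and two more vertices would be 2K + 2 distinct vertices of ts.
  outside-unique : ∀ {ts P Q} → Unique ts → length ts ≡ suc (K + K) → P ≢ Q → Full ts P → Full ts Q →
                   ∀ {o o'} → o ∈ ts → o' ∈ ts → Outside P Q o → Outside P Q o' → o ≡ o'
  outside-unique {ts} {P} {Q} uts len P≢Q fullP fullQ {o} {o'} o∈ o'∈ out out' with o ≟ᵛ o'
  ... | yes o≡o' = o≡o'
  ... | no o≢o' = ⊥-elim (1+n≰n (begin
      2 + (K + K)                               ≡⟨ cong (2 +_) (cong₂ _+_ (length-block P) (length-block Q)) ⟨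
      2 + (length (block P) + length (block Q)) ≡⟨ cong (2 +_) (length-++ (block P)) ⟨
      length (o ∷ o' ∷ block P ++ block Q)      ≤⟨ unique⊆⇒length≤ unique ⊆ts ⟩
      length ts                                 ≡⟨ len ⟩
      suc (K + K)                               ∎))
    where
    open ≤-Reasoning
    ∉blocks : ∀ {v} → Outside P Q v → ∀ {b} → b ∈ block P ++ block Q → v ≢ b
    ∉blocks (v∉P , v∉Q) b∈ refl with ∈-++⁻ (block P) b∈
    ... | inj₁ b∈P = v∉P (block-part b∈P)
    ... | inj₂ b∈Q = v∉Q (block-part b∈Q)
    unique : Unique (o ∷ o' ∷ block P ++ block Q)
    unique = (o≢o' ∷ All.tabulate (∉blocks out)) ∷ All.tabulate (∉blocks out')
           ∷ unique-++⁺ (block-unique P) (block-unique Q)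
                        (λ (b∈P , b∈Q) → P≢Q (trans (sym (block-part b∈P)) (block-part b∈Q)))
    ⊆ts : o ∷ o' ∷ block P ++ block Q ⊆ ts
    ⊆ts (here refl)         = o∈
    ⊆ts (there (here refl)) = o'∈
    ⊆ts {i , j} (there (there v∈)) with ∈-++⁻ (block P) v∈
    ... | inj₁ v∈P = subst (λ p → (p , j) ∈ ts) (sym (block-part v∈P)) (fullP j)
    ... | inj₂ v∈Q = subst (λ p → (p , j) ∈ ts) (sym (block-part v∈Q)) (fullQ j)

  CoversFull : List Vertex → Vertex → Vertex → Set
  CoversFull ts x y = ∀ i → Full ts i → i ≡ part x ⊎ i ≡ part y

  -- covers-full leaves every other part a free layer for the transversal through x and y.
  record CrossingPair (ts : List Vertex) : Set where
    field
      x y          : Vertex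
      rest         : List Vertex
      rotation     : Star Rotation ts (x ∷ y ∷ rest)
      parts-differ : part x ≢ part y
      covers-full  : CoversFull ts x y

  crossing-in-arc : ∀ {ts} Pre L → Star Rotation ts (Pre ++ L) → ∀ P {z z'} →
                    z ∈ L → part z ≡ P → z' ∈ L → part z' ≢ P →
                    (∀ {a b} → b ∈ L → part a ≡ P → part b ≢ P → CoversFull ts a b) →
                    CrossingPair ts
  crossing-in-arc {ts} Pre L rots P z∈ z∈P z'∈ z'∉P covers
    with straddling L₁ L₂ x y refl straddles ← ∃-straddling-pair (λ v → part v ≟ P) L z∈ z∈P z'∈ z'∉P
    = record
    { x            = x
    ; y            = y
    ; rest         = L₂ ++ Pre ++ L₁
    ; rotation     = rots ◅◅ subst (λ L' → Rotation L' (x ∷ y ∷ L₂ ++ Pre ++ L₁)) (++-assoc Pre L₁ _)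
                                   (rotate (Pre ++ L₁) (x ∷ y ∷ L₂)) ◅ ε
    ; parts-differ = parts-differ straddles
    ; covers-full  = covers-full straddles
    }
    where
    x∈ : x ∈ L₁ ++ x ∷ y ∷ L₂
    x∈ = ∈-++⁺ʳ L₁ (here refl)
    y∈ : y ∈ L₁ ++ x ∷ y ∷ L₂
    y∈ = ∈-++⁺ʳ L₁ (there (here refl))
    parts-differ : Straddles (λ v → part v ≡ P) x y → part x ≢ part y
    parts-differ (inj₁ (x∈P , y∉P)) x≡y = y∉P (trans (sym x≡y) x∈P)
    parts-differ (inj₂ (x∉P , y∈P)) x≡y = x∉P (trans x≡y y∈P)
    covers-full : Straddles (λ v → part v ≡ P) x y → CoversFull ts x y
    covers-full (inj₁ (x∈P , y∉P))        = covers {x} y∈ x∈P y∉P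
    covers-full (inj₂ (x∉P , y∈P)) i full = Sum.swap (covers {y} x∈ y∈P x∉P i full)

  crossing-one-full : ∀ {ts} → Unique ts → K < length ts → ∀ P {z} → z ∈ ts → part z ≡ P →
                      (∀ i → Full ts i → i ≡ P) → CrossingPair ts
  crossing-one-full uts K<len P z∈ z∈P only-P with z' , z'∈ , z'∉P ← ∃-outside-part uts K<len P =
    crossing-in-arc [] _ ε P z∈ z∈P z'∈ z'∉P (λ _ a∈P _ i full → inj₁ (trans (only-P i full) (sym a∈P)))

  module _ {ts} (j : Fin K) {P Q} (P≢Q : P ≢ Q) (fullP : Full ts P) (fullQ : Full ts Q)
           (only-PQ : ∀ i → Full ts i → i ≡ P ⊎ i ≡ Q) where

    crossing-in-PQ-arc : ∀ Pre L → Star Rotation ts (Pre ++ L) →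
                         (∀ {v} → v ∈ ts → ¬ Outside P Q v → v ∈ L) →
                         (∀ {v} → v ∈ L → part v ≡ P ⊎ part v ≡ Q) → CrossingPair ts
    crossing-in-PQ-arc Pre L rots inside⊆L L⊆PQ =
      crossing-in-arc Pre L rots P (inside⊆L (fullP j) (λ (≢P , _) → ≢P refl)) refl
                                   (inside⊆L (fullQ j) (λ (_ , ≢Q) → ≢Q refl)) (P≢Q ∘ sym)
                                   (λ {a} → covers {a})
      where
      covers : ∀ {a b} → b ∈ L → part a ≡ P → part b ≢ P → CoversFull ts a b
      covers b∈ a∈P b∉P i full with only-PQ i full | L⊆PQ b∈
      ... | inj₁ i≡P | _        = inj₁ (trans i≡P (sym a∈P))
      ... | inj₂ _   | inj₁ b∈P = ⊥-elim (b∉P b∈P)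
      ... | inj₂ i≡Q | inj₂ b∈Q = inj₂ (trans i≡Q (sym b∈Q))

    crossing-two-full : Unique ts → length ts ≡ suc (K + K) → CrossingPair ts
    crossing-two-full uts len with any? (outside? P Q) ts
    ... | no none = crossing-in-PQ-arc [] ts ε (λ v∈ _ → v∈) (λ {v} v∈ → ¬outside {v = v} (none ∘ lose v∈))
    ... | yes some with o , o∈ , o-out ← find some with A , B , refl ← ∈-∃++ o∈ =
      crossing-in-PQ-arc [ o ] (B ++ A) (rotate A (o ∷ B) ◅ ε) inside⊆L L⊆PQ
      where
      rotated : A ++ o ∷ B ↭ o ∷ B ++ A
      rotated = ++-comm A (o ∷ B)
      inside⊆L : ∀ {v} → v ∈ A ++ o ∷ B → ¬ Outside P Q v → v ∈ B ++ A
      inside⊆L v∈ v-in = tail (λ { refl → v-in o-out }) (∈-resp-↭ rotated v∈)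
      L⊆PQ : ∀ {v} → v ∈ B ++ A → part v ≡ P ⊎ part v ≡ Q
      L⊆PQ {v} v∈ with o∉ ∷ _ ← unique-resp-↭ rotated uts = ¬outside {v = v} λ v-out →
        All.lookup o∉ v∈ (outside-unique uts len P≢Q fullP fullQ o∈ (∈-resp-↭ (↭-sym rotated) (there v∈))
                                         o-out v-out)

  crossingPair : ∀ {j₀ j₁ : Fin K} → j₀ ≢ j₁ → ∀ {ts} → Unique ts → length ts ≡ suc (K + K) →
                 CrossingPair ts
  crossingPair {j₀} {j₁} j₀≢j₁ {ts@(t₀ ∷ _)} uts len =
    by-full-parts (filter (full? ts) (allFin m)) (λ i full → ∈-filter⁺ (full? ts) (∈-allFin i) full)
      (proj₂ ∘ ∈-filter⁻ (full? ts) {xs = allFin m}) (Unique.filter⁺ (full? ts) (Unique.allFin⁺ m))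
    where
    K<len : K < length ts
    K<len = subst (K <_) (sym len) (s≤s (m≤m+n K K))
    by-full-parts : ∀ Fs → (∀ i → Full ts i → i ∈ Fs) → (∀ {i} → i ∈ Fs → Full ts i) → Unique Fs →
                    CrossingPair ts
    by-full-parts [] full⇒∈ _ _ =
      crossing-one-full uts K<len (part t₀) (here refl) refl (λ i full → case full⇒∈ i full of λ ())
    by-full-parts (P ∷ []) full⇒∈ ∈⇒full _ =
      crossing-one-full uts K<len P (∈⇒full (here refl) j₀) refl
        (λ i full → case full⇒∈ i full of λ { (here i≡P) → i≡P })
    by-full-parts (P ∷ Q ∷ []) full⇒∈ ∈⇒full ((P≢Q ∷ []) ∷ _) =
      crossing-two-full j₀ P≢Q (∈⇒full (here refl)) (∈⇒full (there (here refl))) only-PQ uts len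
      where
      only-PQ : ∀ i → Full ts i → i ≡ P ⊎ i ≡ Q
      only-PQ i full with full⇒∈ i full
      ... | here i≡P         = inj₁ i≡P
      ... | there (here i≡Q) = inj₂ i≡Q
    by-full-parts (P ∷ Q ∷ R ∷ _) _ ∈⇒full ((P≢Q ∷ P≢R ∷ _) ∷ (Q≢R ∷ _) ∷ _) =
      ⊥-elim (j₀≢j₁ (cong proj₂ (outside-unique uts len P≢Q (∈⇒full (here refl)) (∈⇒full (there (here refl)))
                                   (fullR j₀) (fullR j₁) R-outside R-outside)))
      where
      fullR = ∈⇒full (there (there (here refl)))
      R-outside = ≢-sym P≢R , ≢-sym Q≢R

  record RemovablePair (ts : List Vertex) : Set where
    field
      u x y w      : Vertex
      rest         : List Vertex
      rotation     : Star Rotation ts (u ∷ x ∷ y ∷ w ∷ rest)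
      parts-differ : part x ≢ part y
      covers-full  : CoversFull ts x y

  crossing⇒removable : ∀ {ts} → 4 ≤ length ts → CrossingPair ts → RemovablePair ts
  crossing⇒removable 4≤len C
    with CrossingPair.rest C | CrossingPair.rotation C | ↭-length (rotations⇒↭ (CrossingPair.rotation C))
  ... | [] | _ | len≡ with s≤s (s≤s ()) ← subst (4 ≤_) len≡ 4≤len
  ... | w ∷ rest | rots | len≡ with initLast rest
  ...   | [] with s≤s (s≤s (s≤s ())) ← subst (4 ≤_) len≡ 4≤len
  ...   | rest' ∷ʳ′ u = record
    { rotation     = rots ◅◅ rotate (x ∷ y ∷ w ∷ rest') [ u ] ◅ ε
    ; parts-differ = parts-differ
    ; covers-full  = covers-full
    }
    where open CrossingPair C hiding (rest; rotation)

module _ {n : ℕ} where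

  cycleThrough-one-layer : ∀ (ts : List (BraceletVertex 1 (suc n))) → Unique ts → length ts ≡ 3 → CycleThrough ts
  cycleThrough-one-layer ((a , zero) ∷ (b , zero) ∷ (c , zero) ∷ [])
                         ((a≢b ∷ a≢c ∷ []) ∷ (b≢c ∷ []) ∷ [] ∷ []) refl
    with R , ρ , bc⊑ ← round-through a (b≢c ∘ cong (_, zero)) (a≢c ∘ sym ∘ cong (_, zero)) =
    cycleThrough (map T (a ∷ R)) (Unique.map⁺ (transversal-injective ℓ₀) (Round.unique ρ)) (lift-round ℓ₀ ρ)
                 (refl ∷ map⁺ T (∷ʳ⁻ (a≢b ∘ sym ∘ cong (_, zero)) bc⊑))
    where
    ℓ₀ : Fin (suc n) → Fin 1
    ℓ₀ _ = zero
    T = transversal ℓ₀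

  module _ (4≤m : 4 ≤ suc n) where

    reinsert : ∀ {k} (ℓ : Fin (suc n) → Fin (suc k)) {u x y w rest} → part x ≢ part y →
               ℓ (part x) ≡ proj₂ x → ℓ (part y) ≡ proj₂ y →
               Unique (u ∷ w ∷ rest) → (∀ {v} → v ∈ u ∷ w ∷ rest → OffTransversal ℓ v) →
               (∀ ts' → Unique ts' → length ts' ≡ length (u ∷ w ∷ rest) → CycleThrough ts') →
               CycleThrough (u ∷ x ∷ y ∷ w ∷ rest)
    reinsert ℓ {x = _ , _} {y = _ , _} x≢y refl refl u-remaining off smaller
      with ts' , raised≡ ← raise-onto ℓ _ off
      with C , off-C ← raise-cycleThrough ℓ raised≡
             (smaller ts' (Unique.map⁻ (subst Unique (sym raised≡) u-remaining))
                          (trans (sym (length-map (raise ℓ) ts')) (cong length raised≡)))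
      = insert ℓ 4≤m C off-C x≢y

    remove-reinsert : ∀ {k} {ts : List (BraceletVertex (suc (suc k)) (suc n))} → Unique ts → RemovablePair ts →
      (∀ ts' → Unique ts' → 2 + length ts' ≡ length ts → CycleThrough ts') → CycleThrough ts
    remove-reinsert {ts = ts} uts removable smaller = cycleThrough-rotations rotation reinserted
      where
      open RemovablePair removable
      ts↭ = rotations⇒↭ rotation
      free : ∀ i → i ≢ part x → i ≢ part y → ∃ λ j → (i , j) ∉ u ∷ w ∷ rest
      free i i≢x i≢y with j , j∉ts ← ¬full⇒free (λ full → Sum.[ i≢x , i≢y ] (covers-full i full)) =
        j , λ { (here refl) → j∉ts (∈-resp-↭ (↭-sym ts↭) (here refl))
              ; (there v∈)  → j∉ts (∈-resp-↭ (↭-sym ts↭) (there (there (there v∈)))) }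
      reinserted : CycleThrough (u ∷ x ∷ y ∷ w ∷ rest)
      reinserted
        with u-remaining , x∉ , y∉ ← unique-drop-pair (unique-resp-↭ ts↭ uts)
        with ℓ , ℓx≡ , ℓy≡ , T∉ ← choose-transversal parts-differ x∉ y∉ free =
        reinsert ℓ parts-differ ℓx≡ ℓy≡ u-remaining (∉-transversal⇒off ℓ T∉)
          λ ts' uts' len' → smaller ts' uts' (trans (cong (2 +_) len') (sym (↭-length ts↭)))

    cycleThrough-all : ∀ k (ts : List (BraceletVertex (suc k) (suc n))) → Unique ts →
                       length ts ≡ suc (suc k + suc k) → CycleThrough ts
    cycleThrough-all zero = cycleThrough-one-layer
    cycleThrough-all (suc k) ts uts len =
      remove-reinsert uts (crossing⇒removable 4≤len (crossingPair {j₀ = zero} {j₁ = suc zero} (λ ()) uts len))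
        λ ts' uts' len' → cycleThrough-all k ts' uts' (trans (suc-injective (suc-injective (trans len' len)))
                                                             (cong suc (+-suc k (suc k))))
      where
      4≤len : 4 ≤ length ts
      4≤len = subst (4 ≤_) (sym len) (s≤s (s≤s (s≤s (≤-trans (s≤s z≤n) (m≤n+m (suc (suc k)) k)))))

corollary2p3 : (k m : ℕ) → 1 ≤ k → 4 ≤ m →
    Ordered (BraceletAdj k m) (2 * k + 1)
corollary2p3 (suc k) (suc n) _ 4≤m =
  cycleThrough⇒ordered 3≤r λ v v-injective →
    cycleThrough-all 4≤m k (tabulate v) (Unique.tabulate⁺ v-injective) (trans (length-tabulate v) r≡)
  where
  r≡ : 2 * suc k + 1 ≡ suc (suc k + suc k)
  r≡ = trans (+-comm (2 * suc k) 1) (cong (λ t → suc (suc k + t)) (+-identityʳ (suc k)))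
  3≤r : 3 ≤ 2 * suc k + 1
  3≤r = subst (3 ≤_) (sym r≡) (s≤s (s≤s (≤-trans (s≤s z≤n) (m≤n+m (suc k) k))))
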